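{- The tree $T^*$ is not $6$-repeating; in particular, not every forest is $6$-repeating.
   Context: $T^*$ is the tree on seven vertices $v_1,\dots,v_7$ with edges $v_1v_2, v_2v_3, v_3v_4, v_4v_5, v_3v_6, v_6v_7$ (three paths of length two joined at the central vertex $v_3$). For $q\in\mathbb{N}$, a closed walk $(u_0,\dots,u_r=u_0)$ is $q$-repeating if there exist $0\le t<t'\le r-1$ with $t\equiv t'\pmod q$ and $u_t=u_{t'}$; a graph is $q$-repeating if for every integer $j\ge2$, every closed walk on it of length $jq$ is $q$-repeating. -}

module Defs where

open import Data.Nat using (ℕ; zero; suc; _*_; _∸_; _<_; _≤_)
open import Data.Nat.Divisibility using (_∣_)
open import Data.Fin using (Fin; zero; suc)
open import Data.Product using (Σ; ∃; _×_; _,_)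
open import Relation.Binary.PropositionalEquality using (_≡_)
open import Relation.Nullary using (¬_)

record Graph : Set₁ where
  field
    V   : Set
    Adj : V → V → Set
open Graph public

-- A closed walk (u 0, …, u r = u 0) of length r in G, encoded as a
-- sequence ℕ → V (values beyond index r are irrelevant).
ClosedWalk : (G : Graph) → ℕ → (ℕ → V G) → Set
ClosedWalk G r u = (∀ i → i < r → Adj G (u i) (u (suc i))) × (u r ≡ u 0)

-- t ≡ t' (mod q), for t ≤ t'
_≡_[mod_] : ℕ → ℕ → ℕ → Set
t ≡ t' [mod q ] = q ∣ (t' ∸ t)

RepeatingWalk : {V : Set} → ℕ → ℕ → (ℕ → V) → Set
RepeatingWalk q r u =
  Σ ℕ λ t → Σ ℕ λ t' → t < t' × t' ≤ r ∸ 1 × t ≡ t' [mod q ] × u t ≡ u t'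

Repeating : ℕ → Graph → Set
Repeating q G = ∀ j → 2 ≤ j → (u : ℕ → V G) → ClosedWalk G (j * q) u →
  RepeatingWalk q (j * q) u

-- Edges of T*: v1v2, v2v3, v3v4, v4v5, v3v6, v6v7, with v_k ↦ Fin index k-1.
data T*Edge : Fin 7 → Fin 7 → Set where
  e12 : T*Edge (zero) (suc zero)
  e23 : T*Edge (suc zero) (suc (suc zero))
  e34 : T*Edge (suc (suc zero)) (suc (suc (suc zero)))
  e45 : T*Edge (suc (suc (suc zero))) (suc (suc (suc (suc zero))))
  e36 : T*Edge (suc (suc zero)) (suc (suc (suc (suc (suc zero)))))
  e67 : T*Edge (suc (suc (suc (suc (suc zero))))) (suc (suc (suc (suc (suc (suc zero))))))

data T*Adj (x y : Fin 7) : Set where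
  fwd : T*Edge x y → T*Adj x y
  bwd : T*Edge y x → T*Adj x y

T* : Graph
T* = record { V = Fin 7 ; Adj = T*Adj }

SimpleGraph : ℕ → Set₁
SimpleGraph n = Σ (Fin n → Fin n → Set) λ A →
  (∀ x y → A x y → A y x) × (∀ x → ¬ A x x)

asGraph : ∀ {n} → SimpleGraph n → Graph
asGraph {n} (A , _) = record { V = Fin n ; Adj = A }

IsCycle : (G : Graph) → ℕ → (ℕ → V G) → Set
IsCycle G r u = 3 ≤ r × ClosedWalk G r u ×
  (∀ i j → i < r → j < r → u i ≡ u j → i ≡ j)

IsForest : ∀ {n} → SimpleGraph n → Set
IsForest G = ∀ r (u : ℕ → V (asGraph G)) → ¬ IsCycle (asGraph G) r u

-- The closed walk v1 v2 v3 v4 v5 v4 v3 v6 v7 v6 v3 v2 (v1) of length 12 runs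
-- through the three arms of T* so that the vertices at positions t and t + 6
-- always differ, and 6 is the only positive multiple of 6 below 12; so T* is
-- not 6-repeating. T* is a forest: the vertex set of a cycle induces a
-- subgraph of minimum degree 2, and pruning the leaves of T*, then the
-- vertices v2, v4, v6 they leave with one neighbour, and finally v3, shows
-- that no vertex of T* can lie in such a subgraph.
module Submission where

open import Defs
open import Data.Nat using (ℕ; zero; suc; _+_; _*_; _∸_; _<_; _≤_; z≤n; s≤s)
open import Data.Nat.Properties
  using ( +-identityʳ; +-cancelʳ-≤; *-monoˡ-≤; m+n≮m; m<n+m; n<1+n; m∸n≤m
        ; m<n⇒0<n∸m; m+[n∸m]≡n; ≤-trans; <⇒≤; <⇒≱; <⇒≢; m≤n⇒m<n∨m≡n )
open import Data.Nat.Divisibility using (_∣_; divides)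
open import Data.Fin using (Fin; zero; suc)
open import Data.Product using (∃; _×_; _,_)
open import Data.Sum using (inj₁; inj₂)
open import Data.Empty using (⊥-elim)
open import Relation.Nullary using (¬_; contradiction)
open import Relation.Binary.PropositionalEquality

pattern v1 = zero
pattern v2 = suc zero
pattern v3 = suc (suc zero)
pattern v4 = suc (suc (suc zero))
pattern v5 = suc (suc (suc (suc zero)))
pattern v6 = suc (suc (suc (suc (suc zero))))
pattern v7 = suc (suc (suc (suc (suc (suc zero)))))

multiple-between⇒≡ : ∀ {d m} → d ∣ m → 0 < m → m < 2 * d → m ≡ d
multiple-between⇒≡ (divides zero refl) () _
multiple-between⇒≡ {d} (divides (suc zero) refl) _ _ = +-identityʳ d
multiple-between⇒≡ {d} (divides (suc (suc k)) refl) _ m<2d =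
  contradiction (*-monoˡ-≤ d {2} {2 + k} (s≤s (s≤s z≤n))) (<⇒≱ m<2d)

armTour : ℕ → Fin 7
armTour 0 = v1
armTour 1 = v2
armTour 2 = v3
armTour 3 = v4
armTour 4 = v5
armTour 5 = v4
armTour 6 = v3
armTour 7 = v6
armTour 8 = v7
armTour 9 = v6
armTour 10 = v3
armTour 11 = v2
armTour _ = v1

armTour-closedWalk : ClosedWalk T* 12 armTour
armTour-closedWalk = steps , refl
  where
  steps : ∀ i → i < 12 → T*Adj (armTour i) (armTour (suc i))
  steps 0 _ = fwd e12
  steps 1 _ = fwd e23
  steps 2 _ = fwd e34
  steps 3 _ = fwd e45
  steps 4 _ = bwd e45
  steps 5 _ = bwd e34
  steps 6 _ = fwd e36
  steps 7 _ = fwd e67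
  steps 8 _ = bwd e67
  steps 9 _ = bwd e36
  steps 10 _ = bwd e23
  steps 11 _ = bwd e12
  steps (suc (suc (suc (suc (suc (suc (suc (suc (suc (suc (suc (suc i)))))))))))) i<12 =
    contradiction i<12 (m+n≮m 12 i)

armTour-antipodes-differ : ∀ t → t < 6 → armTour t ≢ armTour (t + 6)
armTour-antipodes-differ 0 _ ()
armTour-antipodes-differ 1 _ ()
armTour-antipodes-differ 2 _ ()
armTour-antipodes-differ 3 _ ()
armTour-antipodes-differ 4 _ ()
armTour-antipodes-differ 5 _ ()
armTour-antipodes-differ (suc (suc (suc (suc (suc (suc t)))))) t<6 =
  contradiction t<6 (m+n≮m 6 t)

armTour-not-repeating : ¬ RepeatingWalk 6 12 armTour
armTour-not-repeating (t , t' , t<t' , t'≤11 , 6∣t'∸t , same) =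
  armTour-antipodes-differ t t<6 (trans same (cong armTour t'≡t+6))
  where
  gap≡6 : t' ∸ t ≡ 6
  gap≡6 = multiple-between⇒≡ 6∣t'∸t (m<n⇒0<n∸m t<t') (s≤s (≤-trans (m∸n≤m t' t) t'≤11))

  t'≡t+6 : t' ≡ t + 6
  t'≡t+6 = trans (sym (m+[n∸m]≡n (<⇒≤ t<t'))) (cong (t +_) gap≡6)

  t<6 : t < 6
  t<6 = +-cancelʳ-≤ 6 (suc t) 6 (s≤s (subst (_≤ 11) t'≡t+6 t'≤11))

T*-not-6-repeating : ¬ Repeating 6 T*
T*-not-6-repeating repeating =
  armTour-not-repeating (repeating 2 (s≤s (s≤s z≤n)) armTour armTour-closedWalk)

record TwoNeighboursIn (G : Graph) (S : V G → Set) (x : V G) : Set where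
  field
    {left right} : V G
    left≢right : left ≢ right
    adj-left : Adj G x left
    adj-right : Adj G x right
    left∈S : S left
    right∈S : S right

MinDegree2 : (G : Graph) → (V G → Set) → Set
MinDegree2 G S = ∀ x → S x → TwoNeighboursIn G S x

minDegree2-excludes : ∀ {G S x} y → MinDegree2 G S →
  (∀ {z} → Adj G x z → S z → z ≡ y) → ¬ S x
minDegree2-excludes y minDeg onlyY x∈S =
  left≢right (trans (onlyY adj-left left∈S) (sym (onlyY adj-right right∈S)))
  where open TwoNeighboursIn (minDeg _ x∈S)

OnWalk : {A : Set} → ℕ → (ℕ → A) → A → Set
OnWalk r u x = ∃ λ i → i < r × u i ≡ x

cycle-minDegree2 : ∀ {G} → (∀ {x y} → Adj G x y → Adj G y x) →
  ∀ {r u} → IsCycle G r u → MinDegree2 G (OnWalk r u)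
cycle-minDegree2 {G} symmetric {u = u}
  (s≤s (s≤s (s≤s {n = k} _)) , (steps , closed) , injective) _ (i , i<r , refl) = neighbours i i<r
  where
  r : ℕ
  r = 3 + k

  twoNeighbours : ∀ {i p n} → p < r → n < r → p ≢ n →
    Adj G (u i) (u p) → Adj G (u i) (u n) → TwoNeighboursIn G (OnWalk r u) (u i)
  twoNeighbours p<r n<r p≢n adj-p adj-n = record
    { left≢right = λ same → p≢n (injective _ _ p<r n<r same)
    ; adj-left = adj-p
    ; adj-right = adj-n
    ; left∈S = _ , p<r , refl
    ; right∈S = _ , n<r , refl
    }

  neighbours : ∀ i → i < r → TwoNeighboursIn G (OnWalk r u) (u i)
  neighbours zero 0<r = twoNeighbours {p = 1} {n = 2 + k} (s≤s (s≤s z≤n)) (n<1+n _) (λ ())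
    (steps 0 0<r) (symmetric (subst (Adj G _) closed (steps (2 + k) (n<1+n _))))
  neighbours (suc i) i+1<r with m≤n⇒m<n∨m≡n i+1<r
  ... | inj₁ i+2<r =
    twoNeighbours {p = i} {n = 2 + i} (<⇒≤ i+1<r) i+2<r (<⇒≢ (m<n+m i (s≤s z≤n)))
    (symmetric (steps i (<⇒≤ i+1<r))) (steps (suc i) i+1<r)
  ... | inj₂ i+2≡r = twoNeighbours {p = i} {n = 0} (<⇒≤ i+1<r) (s≤s z≤n) i≢0
    (symmetric (steps i (<⇒≤ i+1<r)))
    (subst (Adj G _) (trans (cong u i+2≡r) closed) (steps (suc i) i+1<r))
    where
    i≢0 : i ≢ 0
    i≢0 refl = contradiction i+2≡r λ ()

T*-symmetric : ∀ {x y} → T*Adj x y → T*Adj y x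
T*-symmetric (fwd e) = bwd e
T*-symmetric (bwd e) = fwd e

T*-irreflexive : ∀ x → ¬ T*Adj x x
T*-irreflexive _ (fwd ())
T*-irreflexive _ (bwd ())

T*-no-minDegree2 : ∀ {S} → MinDegree2 T* S → ∀ x → ¬ S x
T*-no-minDegree2 {S} minDeg = λ where
    v1 → ∉v1
    v2 → ∉v2
    v3 → ∉v3
    v4 → ∉v4
    v5 → ∉v5
    v6 → ∉v6
    v7 → ∉v7
  where
  ∉v1 : ¬ S v1
  ∉v1 = minDegree2-excludes v2 minDeg λ { (fwd e12) _ → refl }
  ∉v5 : ¬ S v5
  ∉v5 = minDegree2-excludes v4 minDeg λ { (bwd e45) _ → refl }
  ∉v7 : ¬ S v7
  ∉v7 = minDegree2-excludes v6 minDeg λ { (bwd e67) _ → refl }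
  ∉v2 : ¬ S v2
  ∉v2 = minDegree2-excludes v3 minDeg λ
    { (fwd e23) _ → refl
    ; (bwd e12) v1∈S → ⊥-elim (∉v1 v1∈S)
    }
  ∉v4 : ¬ S v4
  ∉v4 = minDegree2-excludes v3 minDeg λ
    { (bwd e34) _ → refl
    ; (fwd e45) v5∈S → ⊥-elim (∉v5 v5∈S)
    }
  ∉v6 : ¬ S v6
  ∉v6 = minDegree2-excludes v3 minDeg λ
    { (bwd e36) _ → refl
    ; (fwd e67) v7∈S → ⊥-elim (∉v7 v7∈S)
    }
  ∉v3 : ¬ S v3
  ∉v3 = minDegree2-excludes v2 minDeg λ
    { (bwd e23) _ → refl
    ; (fwd e34) v4∈S → ⊥-elim (∉v4 v4∈S)
    ; (fwd e36) v6∈S → ⊥-elim (∉v6 v6∈S)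
    }

T*-simpleGraph : SimpleGraph 7
T*-simpleGraph = T*Adj , (λ _ _ → T*-symmetric) , T*-irreflexive

T*-forest : IsForest T*-simpleGraph
T*-forest r u cycle@(3≤r , _) =
  T*-no-minDegree2 (cycle-minDegree2 T*-symmetric cycle) (u 0)
    (0 , ≤-trans (s≤s z≤n) 3≤r , refl)

lemma4 : ¬ Repeating 6 T* ×
    ¬ (∀ (n : ℕ) (G : SimpleGraph n) → IsForest G → Repeating 6 (asGraph G))
lemma4 = T*-not-6-repeating , λ forests-repeat →
  T*-not-6-repeating (forests-repeat 7 T*-simpleGraph T*-forest)
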